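{- Let $\mathbb{F}_q$ be a finite field and $\gamma\neq 0$ an element of some finite extension of $\mathbb{F}_q$, of degree $g$ over $\mathbb{F}_q$. Then for any matrix $M\in\mathbb{F}_q^{n\times n}$ and any positive integer $r$, \[ \textsf{r}^{\mathbb{F}_q}_M(gr)\le \textsf{r}^{\mathbb{F}_q[\gamma]}_M(r). \]
   Context: The degree of $\gamma$ over $\mathbb{F}_q$ is the degree of its minimal polynomial; $\mathbb{F}_q[\gamma]$ is the field generated by $\gamma$ over $\mathbb{F}_q$. $\textsf{r}^{\mathbb{F}}_M(r)$ is the smallest $s$ such that $M=E+F$ with $E,F$ having entries in $\mathbb{F}$, $E$ having at most $s$ nonzero entries in each row and column, and $\operatorname{rank}_{\mathbb{F}}(F)\le r$. -}

module Defs where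

open import Level using (Level; _⊔_) renaming (suc to lsuc)
open import Data.Nat using (ℕ; zero; suc; _≤_)
import Data.Fin
open Data.Fin using (Fin)
open import Data.Product using (Σ; ∃; _×_; _,_)
open import Data.List using (List; length)
open import Data.List.Membership.Propositional using (_∈_)
open import Relation.Nullary using (¬_)
open import Relation.Binary.PropositionalEquality using (_≡_)
open import Function.Definitions using (Injective)
open import Algebra.Bundles using (CommutativeRing)
open import Algebra.Morphism.Structures using (module RingMorphisms)

record Field (c ℓ : Level) : Set (lsuc (c ⊔ ℓ)) where
  field
    commutativeRing : CommutativeRing c ℓ
  open CommutativeRing commutativeRing public
  field
    1≉0     : ¬ (1# ≈ 0#)
    inverse : ∀ x → ¬ (x ≈ 0#) → ∃ λ y → (x * y) ≈ 1#

IsFinite : ∀ {c ℓ} → Field c ℓ → Set (c ⊔ ℓ)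
IsFinite F = Σ ℕ λ q → Σ (Fin q → Carrier) λ e → ∀ x → ∃ λ i → e i ≈ x
  where open Field F

-- K is an extension of F via the (necessarily injective) ring homomorphism ι.
IsFieldEmbedding : ∀ {c ℓ c' ℓ'} (F : Field c ℓ) (K : Field c' ℓ') →
                   (Field.Carrier F → Field.Carrier K) → Set (c ⊔ ℓ ⊔ ℓ')
IsFieldEmbedding F K ι =
  RingMorphisms.IsRingHomomorphism (Field.rawRing F) (Field.rawRing K) ι

Matrix : ∀ {a} → Set a → ℕ → Set a
Matrix A n = Fin n → Fin n → A

module LinAlg {c ℓ} (R : CommutativeRing c ℓ) where
  open CommutativeRing R

  sumF : ∀ {k} → (Fin k → Carrier) → Carrier
  sumF {zero}  v = 0#
  sumF {suc k} v = v Fin.zero + sumF (λ i → v (Fin.suc i))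

  pow : Carrier → ℕ → Carrier
  pow x zero    = 1#
  pow x (suc k) = x * pow x k

  -- Linear algebra over the subfield of R described by the predicate P
  -- (P = everything for the base field itself).
  module Over {p} (P : Carrier → Set p) where

    RowsDependent : ∀ {n r} → Matrix Carrier n → (Fin (suc r) → Fin n) → Set (c ⊔ ℓ ⊔ p)
    RowsDependent {n} {r} X f =
      Σ (Fin (suc r) → Carrier) λ coef →
        (∀ k → P (coef k)) ×
        (∃ λ k → ¬ (coef k ≈ 0#)) ×
        (∀ j → sumF (λ k → coef k * X (f k) j) ≈ 0#)

    RankAtMost : ∀ {n} → ℕ → Matrix Carrier n → Set (c ⊔ ℓ ⊔ p)
    RankAtMost {n} r X =
      (f : Fin (suc r) → Fin n) → Injective _≡_ _≡_ f → RowsDependent X f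

    SparseRows : ∀ {n} → ℕ → Matrix Carrier n → Set ℓ
    SparseRows {n} s E = ∀ i → Σ (List (Fin n)) λ js → length js ≤ s ×
                           (∀ j → ¬ (j ∈ js) → E i j ≈ 0#)

    SparseCols : ∀ {n} → ℕ → Matrix Carrier n → Set ℓ
    SparseCols {n} s E = ∀ j → Σ (List (Fin n)) λ is → length is ≤ s ×
                           (∀ i → ¬ (i ∈ is) → E i j ≈ 0#)

    Decomposable : ∀ {n} → Matrix Carrier n → ℕ → ℕ → Set (c ⊔ ℓ ⊔ p)
    Decomposable {n} M r s =
      Σ (Matrix Carrier n) λ E → Σ (Matrix Carrier n) λ Fm →
        (∀ i j → P (E i j)) × (∀ i j → P (Fm i j)) ×
        SparseRows s E × SparseCols s E × RankAtMost r Fm ×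
        (∀ i j → M i j ≈ (E i j + Fm i j))

    IsRigidity : ∀ {n} → Matrix Carrier n → ℕ → ℕ → Set (c ⊔ ℓ ⊔ p)
    IsRigidity M r s = Decomposable M r s × (∀ s' → Decomposable M r s' → s ≤ s')

module Extension {c ℓ c' ℓ'} (F : Field c ℓ) (K : Field c' ℓ')
                 (ι : Field.Carrier F → Field.Carrier K) where
  open Field K
  open LinAlg (Field.commutativeRing K) using (sumF; pow)

  polyEval : ∀ {d} → (Fin d → Field.Carrier F) → Carrier → Carrier
  polyEval a γ = sumF (λ i → ι (a i) * pow γ (Data.Fin.toℕ i))

  monicEval : ∀ {g} → (Fin g → Field.Carrier F) → Carrier → Carrier
  monicEval {g} a γ = pow γ g + polyEval a γ

  -- g is the degree of the minimal polynomial of γ over F: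
  -- the least degree of a monic polynomial over F vanishing at γ
  HasDegree : Carrier → ℕ → Set (c ⊔ ℓ')
  HasDegree γ g =
    (Σ (Fin g → Field.Carrier F) λ a → monicEval a γ ≈ 0#) ×
    (∀ g' → (a : Fin g' → Field.Carrier F) → monicEval a γ ≈ 0# → g ≤ g')

  InAdjoin : Carrier → Carrier → Set (c ⊔ ℓ')
  InAdjoin γ x = Σ ℕ λ d → Σ (Fin d → Field.Carrier F) λ a → x ≈ polyEval a γ

module Submission where

open import Defs
open import Level using (Level)
open import Data.Nat using (ℕ; suc; _≤_; _*_)
open import Data.Unit.Polymorphic using (⊤)
open import Relation.Nullary using (¬_)

open import Level using (_⊔_)
open import Data.Nat as ℕ using (zero; z≤n; s≤s)
import Data.Nat.Properties as ℕP
open import Data.Fin using (Fin; zero; suc; punchIn; toℕ; fromℕ; inject₁; splitAt)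
import Data.Fin.Properties as FinP
open import Data.Fin.Relation.Unary.Top using (view; ‵fromℕ; ‵inj₁)
open import Data.Vec.Functional using (_∷_; _++_; insertAt)
open import Data.Vec.Functional.Properties using (insertAt-lookup; insertAt-punchIn)
open import Data.Product using (Σ; ∃; ∃₂; _×_; _,_; proj₁; proj₂)
open import Data.Sum using (_⊎_; inj₁; inj₂)
open import Data.Bool using (if_then_else_)
open import Data.Empty using (⊥-elim)
open import Data.Unit.Polymorphic using (tt)
open import Function using (_∘_)
open import Function.Definitions using (Injective)
open import Relation.Nullary using (Dec; yes; no; ¬?; does; contradiction; ¬¬-excluded-middle)
open import Relation.Nullary.Negation using (¬¬-map)
open import Relation.Nullary.Decidable using (decidable-stable; map′)
open import Relation.Binary using (Decidable)
open import Relation.Binary.PropositionalEquality as ≡ using (_≡_)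
open import Algebra.Bundles using (CommutativeRing)
open import Algebra.Morphism.Structures using (module RingMorphisms)

-- F[γ] = F·1 ⊕ F·γ ⊕ … ⊕ F·γ^(g-1), and the coordinate of 1 is an
-- F-linear map `const : F[γ] → F` fixing F.  Given M = E + X over F[γ] with E
-- s-sparse and rank X ≤ r, applying `const` entrywise gives M = E′ + X′ over F
-- with E′ s-sparse.  For the rank: Gaussian elimination over the field F[γ]
-- puts any g·r+1 rows of X in the F[γ]-span of at most r vectors z, hence in
-- the F-span of the ≤ g·r vectors γⁱ·z; after `const` they are g·r+1 vectors
-- in an F-span of g·r vectors, hence dependent.  Minimality of s₁ concludes.
--
-- The constructive setting needs
-- decidable equality on F and K, which finiteness provides under double
-- negation; that suffices because the conclusion s₁ ≤ s₂ is decidable.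

∷-injective : ∀ {m N} {h : Fin m → Fin N} {k₀ : Fin N} →
              Injective _≡_ _≡_ h → (∀ q → ¬ h q ≡ k₀) → Injective _≡_ _≡_ (k₀ ∷ h)
∷-injective h-inj fresh {zero}  {zero}  _ = ≡.refl
∷-injective h-inj fresh {zero}  {suc y} e = contradiction (≡.sym e) (fresh y)
∷-injective h-inj fresh {suc x} {zero}  e = contradiction e (fresh x)
∷-injective h-inj fresh {suc x} {suc y} e = ≡.cong suc (h-inj e)

++-all : ∀ {a q} {A : Set a} (Q : A → Set q) {m k} {f : Fin m → A} {h : Fin k → A} →
         (∀ i → Q (f i)) → (∀ i → Q (h i)) → ∀ s → Q ((f ++ h) s)
++-all Q {m} Qf Qh s with splitAt m s
... | inj₁ i = Qf i
... | inj₂ i = Qh i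

module Sums {c ℓ} (R : CommutativeRing c ℓ) where
  open CommutativeRing R hiding (zero) renaming (_*_ to _·_)
  open LinAlg R using (sumF)
  open import Algebra.Properties.CommutativeSemigroup +-commutativeSemigroup
    using (interchange; x∙yz≈y∙xz)
  open import Algebra.Properties.AbelianGroup +-abelianGroup using (ε⁻¹≈ε; ⁻¹-∙-comm)

  sum-cong : ∀ {k} {f h : Fin k → Carrier} → (∀ i → f i ≈ h i) → sumF f ≈ sumF h
  sum-cong {zero}  e = refl
  sum-cong {suc k} e = +-cong (e zero) (sum-cong (e ∘ suc))

  sum-zero : ∀ {k} (f : Fin k → Carrier) → (∀ i → f i ≈ 0#) → sumF f ≈ 0#
  sum-zero {zero}  f e = refl
  sum-zero {suc k} f e = trans (+-cong (e zero) (sum-zero (f ∘ suc) (e ∘ suc))) (+-identityʳ 0#)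

  sum-+ : ∀ {k} (f h : Fin k → Carrier) → sumF (λ i → f i + h i) ≈ sumF f + sumF h
  sum-+ {zero}  f h = sym (+-identityʳ 0#)
  sum-+ {suc k} f h =
    trans (+-congˡ (sum-+ (f ∘ suc) (h ∘ suc))) (interchange _ _ _ _)

  sum-*ˡ : ∀ {k} a (f : Fin k → Carrier) → sumF (λ i → a · f i) ≈ a · sumF f
  sum-*ˡ {zero}  a f = sym (zeroʳ a)
  sum-*ˡ {suc k} a f = trans (+-congˡ (sum-*ˡ a (f ∘ suc))) (sym (distribˡ a _ _))

  sum-*ʳ : ∀ {k} a (f : Fin k → Carrier) → sumF (λ i → f i · a) ≈ sumF f · a
  sum-*ʳ {zero}  a f = sym (zeroˡ a)
  sum-*ʳ {suc k} a f = trans (+-congˡ (sum-*ʳ a (f ∘ suc))) (sym (distribʳ a _ _))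

  sum-comm : ∀ {k m} (f : Fin k → Fin m → Carrier) →
             sumF (λ i → sumF (f i)) ≈ sumF (λ t → sumF (λ i → f i t))
  sum-comm {zero} {m} f = sym (sum-zero {m} (λ _ → 0#) (λ _ → refl))
  sum-comm {suc k} f =
    trans (+-congˡ (sum-comm (f ∘ suc))) (sym (sum-+ (f zero) (λ t → sumF (λ i → f (suc i) t))))

  sum-++ : ∀ {a b} {A : Set a} {B : Set b} {m k}
           (f : Fin m → A) (f′ : Fin k → A) (h : Fin m → B) (h′ : Fin k → B)
           (φ : A → B → Carrier) →
           sumF (λ t → φ ((f ++ f′) t) ((h ++ h′) t)) ≈
           sumF (λ t → φ (f t) (h t)) + sumF (λ t → φ (f′ t) (h′ t))
  sum-++ {m = zero}  f f′ h h′ φ = sym (+-identityˡ _)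
  sum-++ {m = suc m} f f′ h h′ φ =
    trans (+-congˡ (trans (sum-cong tail-++) (sum-++ (f ∘ suc) f′ (h ∘ suc) h′ φ)))
          (sym (+-assoc _ _ _))
    where
    tail-++ : ∀ t → φ ((f ++ f′) (suc t)) ((h ++ h′) (suc t)) ≈
                    φ (((f ∘ suc) ++ f′) t) (((h ∘ suc) ++ h′) t)
    tail-++ t with splitAt m t
    ... | inj₁ _ = refl
    ... | inj₂ _ = refl

  sum-punchIn : ∀ {k} (p : Fin (suc k)) (f : Fin (suc k) → Carrier) →
                sumF f ≈ f p + sumF (f ∘ punchIn p)
  sum-punchIn zero    f = refl
  sum-punchIn {suc k} (suc p) f =
    trans (+-congˡ (sum-punchIn p (f ∘ suc))) (x∙yz≈y∙xz _ _ _)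

  sum-last : ∀ {k} (f : Fin (suc k) → Carrier) → sumF f ≈ sumF (f ∘ inject₁) + f (fromℕ k)
  sum-last {zero}  f = trans (+-identityʳ _) (sym (+-identityˡ _))
  sum-last {suc k} f = trans (+-congˡ (sum-last (f ∘ suc))) (sym (+-assoc _ _ _))

  sum-neg : ∀ {k} (f : Fin k → Carrier) → sumF (λ i → - f i) ≈ - sumF f
  sum-neg {zero}  f = sym ε⁻¹≈ε
  sum-neg {suc k} f = trans (+-congˡ (sum-neg (f ∘ suc))) (⁻¹-∙-comm _ _)

module Powers {c ℓ} (R : CommutativeRing c ℓ) where
  open CommutativeRing R hiding (zero) renaming (_*_ to _·_)
  open LinAlg R using (pow)

  pow-+ : ∀ x m k → pow x (m ℕ.+ k) ≈ pow x m · pow x k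
  pow-+ x zero    k = sym (*-identityˡ _)
  pow-+ x (suc m) k = trans (*-congˡ (pow-+ x m k)) (sym (*-assoc _ _ _))

module Families {c ℓ} (R : CommutativeRing c ℓ) where
  open CommutativeRing R hiding (zero) renaming (_*_ to _·_)
  open LinAlg R using (sumF)

  Dependent : ∀ {p m n} → (Carrier → Set p) → (Fin m → Fin n → Carrier) → Set (c ⊔ ℓ ⊔ p)
  Dependent {m = m} P u =
    Σ (Fin m → Carrier) λ coef → (∀ k → P (coef k)) × (∃ λ k → ¬ coef k ≈ 0#) ×
      (∀ j → sumF (λ k → coef k · u k j) ≈ 0#)

  LowRank : ∀ {p N n} → (Carrier → Set p) → ℕ → (Fin N → Fin n → Carrier) → Set (c ⊔ ℓ ⊔ p)
  LowRank {N = N} P r v =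
    (h : Fin (suc r) → Fin N) → Injective _≡_ _≡_ h → Dependent P (v ∘ h)

  InSpan : ∀ {p N m n} → (Carrier → Set p) →
           (Fin N → Fin n → Carrier) → (Fin m → Fin n → Carrier) → Set (c ⊔ ℓ ⊔ p)
  InSpan {N = N} {m} P v z =
    Σ (Fin N → Fin m → Carrier) λ A → (∀ k t → P (A k t)) ×
      (∀ k j → v k j ≈ sumF (λ t → A k t · z t j))

-- One step of Gaussian elimination on the rows X k: subtract from each row the
-- multiple of a pivot row V that clears column j₀, where ip inverts V j₀.
module Elimination {c ℓ} (R : CommutativeRing c ℓ) where
  open CommutativeRing R hiding (zero) renaming (_*_ to _·_)
  open LinAlg R using (sumF)
  open Sums R
  open import Algebra.Properties.Ring ring using (-‿distribˡ-*; -‿distribʳ-*)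
  open import Algebra.Properties.CommutativeSemigroup +-commutativeSemigroup
    using (x∙yz≈y∙xz)
  open import Algebra.Solver.Ring.NaturalCoefficients.Default commutativeSemiring
  open import Relation.Binary.Reasoning.Setoid setoid

  clear : ∀ {N n} → (Fin N → Fin n → Carrier) → (Fin n → Carrier) → Fin n → Carrier →
          Fin N → Fin n → Carrier
  clear X V j₀ ip k j = X k j - X k j₀ · ip · V j

  clear-restore : ∀ {N n} (X : Fin N → Fin n → Carrier) V j₀ ip k j →
                  X k j ≈ X k j₀ · ip · V j + clear X V j₀ ip k j
  clear-restore X V j₀ ip k j =
    sym (trans (x∙yz≈y∙xz _ _ _) (trans (+-congˡ (-‿inverseʳ _)) (+-identityʳ _)))

  pivot-cancel : ∀ {v ip} → v · ip ≈ 1# → ∀ x → x · ip · v ≈ x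
  pivot-cancel {v} {ip} v·ip≈1 x = begin
    x · ip · v      ≈⟨ solve 3 (λ x ip v → x :* ip :* v := x :* (v :* ip)) refl x ip v ⟩
    x · (v · ip)    ≈⟨ *-congˡ v·ip≈1 ⟩
    x · 1#          ≈⟨ *-identityʳ x ⟩
    x               ∎

  clear-pivotColumn : ∀ {N n} (X : Fin N → Fin n → Carrier) V j₀ ip →
                      V j₀ · ip ≈ 1# → ∀ k → clear X V j₀ ip k j₀ ≈ 0#
  clear-pivotColumn X V j₀ ip v·ip≈1 k =
    trans (+-congˡ (-‿cong (pivot-cancel v·ip≈1 (X k j₀)))) (-‿inverseʳ _)

  clear-pivotRow : ∀ {n} (V : Fin n → Carrier) j₀ ip → V j₀ · ip ≈ 1# →
                   ∀ j → V j - V j₀ · ip · V j ≈ 0#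
  clear-pivotRow V j₀ ip v·ip≈1 j =
    trans (+-congˡ (-‿cong (trans (*-congʳ v·ip≈1) (*-identityˡ _)))) (-‿inverseʳ _)

  clear-sum : ∀ {N n} (X : Fin N → Fin n → Carrier) V j₀ ip (d : Fin N → Carrier) j →
              sumF (λ k → d k · clear X V j₀ ip k j) ≈
              sumF (λ k → d k · X k j) - sumF (λ k → d k · X k j₀) · ip · V j
  clear-sum {N} X V j₀ ip d j = begin
    sumF (λ k → d k · (X k j - X k j₀ · ip · V j))
      ≈⟨ sum-cong (λ k → termwise (d k) (X k j) (X k j₀)) ⟩
    sumF (λ k → d k · X k j + d k · X k j₀ · - (ip · V j))
      ≈⟨ sum-+ {N} _ _ ⟩
    sumF (λ k → d k · X k j) + sumF (λ k → d k · X k j₀ · - (ip · V j))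
      ≈⟨ +-congˡ (sum-*ʳ {N} _ _) ⟩
    sumF (λ k → d k · X k j) + sumF (λ k → d k · X k j₀) · - (ip · V j)
      ≈⟨ +-congˡ (trans (-‿cong (*-assoc _ _ _)) (-‿distribʳ-* _ _)) ⟨
    sumF (λ k → d k · X k j) - sumF (λ k → d k · X k j₀) · ip · V j ∎
    where
    termwise : ∀ e x y → e · (x - y · ip · V j) ≈ e · x + e · y · - (ip · V j)
    termwise e x y = begin
      e · (x - y · ip · V j)            ≈⟨ distribˡ e x _ ⟩
      e · x + e · - (y · ip · V j)      ≈⟨ +-congˡ (-‿distribʳ-* e _) ⟨
      e · x + - (e · (y · ip · V j))
        ≈⟨ +-congˡ (-‿cong (solve 4 (λ e y ip v → e :* (y :* ip :* v) := e :* y :* (ip :* v))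
                                     refl e y ip (V j))) ⟩
      e · x + - (e · y · (ip · V j))    ≈⟨ +-congˡ (-‿distribʳ-* _ _) ⟩
      e · x + e · y · - (ip · V j)      ∎

  clear-proportional : ∀ {n} (V S : Fin n → Carrier) j₀ ip a → V j₀ · ip ≈ 1# →
                       (∀ j → S j ≈ - (a · V j)) → ∀ j → S j - S j₀ · ip · V j ≈ 0#
  clear-proportional V S j₀ ip a v·ip≈1 S≈-aV j = begin
    S j - S j₀ · ip · V j                     ≈⟨ +-cong (S≈-aV j) (-‿cong (*-congʳ (*-congʳ (S≈-aV j₀)))) ⟩
    - (a · V j) - - (a · V j₀) · ip · V j     ≈⟨ +-congˡ (-‿cong (*-congʳ (-‿distribˡ-* _ _))) ⟨
    - (a · V j) - - (a · V j₀ · ip) · V j     ≈⟨ +-congˡ (-‿cong (-‿distribˡ-* _ _)) ⟨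
    - (a · V j) - - (a · V j₀ · ip · V j)     ≈⟨ +-congˡ (-‿cong (-‿cong (cancel-mid a (V j)))) ⟩
    - (a · V j) - - (a · V j)                 ≈⟨ -‿inverseʳ _ ⟩
    0#                                        ∎
    where
    cancel-mid : ∀ x y → x · V j₀ · ip · y ≈ x · y
    cancel-mid x y = begin
      x · V j₀ · ip · y
        ≈⟨ solve 4 (λ x v ip y → x :* v :* ip :* y := x :* (v :* ip) :* y) refl x (V j₀) ip y ⟩
      x · (V j₀ · ip) · y    ≈⟨ *-congʳ (trans (*-congˡ v·ip≈1) (*-identityʳ x)) ⟩
      x · y                  ∎

module FieldFacts {c ℓ} (F : Field c ℓ) where
  open Field F hiding (zero) renaming (_*_ to _·_)
  open LinAlg commutativeRing using (pow)
  open Powers commutativeRing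
  open import Relation.Binary.Reasoning.Setoid setoid

  cancelˡ : ∀ {a x y} → ¬ a ≈ 0# → a · x ≈ a · y → x ≈ y
  cancelˡ {a} {x} {y} a≉0 ax≈ay with inverse a a≉0
  ... | a⁻¹ , aa⁻¹≈1 = begin
    x               ≈⟨ undo x ⟨
    a⁻¹ · (a · x)   ≈⟨ *-congˡ ax≈ay ⟩
    a⁻¹ · (a · y)   ≈⟨ undo y ⟩
    y               ∎
    where
    undo : ∀ z → a⁻¹ · (a · z) ≈ z
    undo z = trans (sym (*-assoc _ _ _))
               (trans (*-congʳ (trans (*-comm _ _) aa⁻¹≈1)) (*-identityˡ z))

  nonzero-· : ∀ {x y} → ¬ x ≈ 0# → ¬ y ≈ 0# → ¬ x · y ≈ 0#
  nonzero-· x≉0 y≉0 xy≈0 = y≉0 (cancelˡ x≉0 (trans xy≈0 (sym (zeroʳ _))))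

  invertible-nonzero : ∀ {x y} → x · y ≈ 1# → ¬ x ≈ 0#
  invertible-nonzero {x} {y} xy≈1 x≈0 =
    1≉0 (trans (sym xy≈1) (trans (*-congʳ x≈0) (zeroˡ y)))

  pow-nonzero : ∀ {x} → ¬ x ≈ 0# → ∀ k → ¬ pow x k ≈ 0#
  pow-nonzero x≉0 zero    = 1≉0
  pow-nonzero x≉0 (suc k) = nonzero-· x≉0 (pow-nonzero x≉0 k)

  -- In a finite field the powers of x ≠ 0 repeat, x ^ i ≈ x ^ (i + 1 + o),
  -- so x ^ o is an inverse of x.
  inverse-power : IsFinite F → ∀ {x} → ¬ x ≈ 0# → ∃ λ o → x · pow x o ≈ 1#
  inverse-power (q , e , onto) {x} x≉0
    with FinP.pigeonhole (ℕP.n<1+n q) (λ k → proj₁ (onto (pow x (toℕ k))))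
  ... | i , j , i<j , same-index with ℕP.m≤n⇒∃[o]m+o≡n i<j
  ...   | o , i+1+o≡j = o , sym (cancelˡ (pow-nonzero x≉0 (toℕ i)) (begin
    pow x (toℕ i) · 1#            ≈⟨ *-identityʳ _ ⟩
    pow x (toℕ i)                 ≈⟨ trans (sym (proj₂ (onto _)))
                                           (trans (reflexive (≡.cong e same-index)) (proj₂ (onto _))) ⟩
    pow x (toℕ j)                 ≡⟨ ≡.cong (pow x) (≡.trans (ℕP.+-suc _ o) i+1+o≡j) ⟨
    pow x (toℕ i ℕ.+ suc o)       ≈⟨ pow-+ x (toℕ i) (suc o) ⟩
    pow x (toℕ i) · (x · pow x o) ∎))

record IsSubfield {c ℓ p} (F : Field c ℓ) (P : Field.Carrier F → Set p) : Set (c ⊔ ℓ ⊔ p) where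
  open Field F renaming (_*_ to _·_)
  field
    0∈ : P 0#
    1∈ : P 1#
    +∈ : ∀ {x y} → P x → P y → P (x + y)
    -∈ : ∀ {x} → P x → P (- x)
    ·∈ : ∀ {x y} → P x → P y → P (x · y)
    inverse∈ : ∀ {x} → P x → ¬ x ≈ 0# → ∃ λ y → P y × x · y ≈ 1#

module LinearAlgebra {c ℓ} (F : Field c ℓ) (_≟_ : Decidable (Field._≈_ F)) where
  open Field F hiding (zero) renaming (_*_ to _·_)
  open LinAlg commutativeRing using (sumF)
  open Sums commutativeRing
  open Families commutativeRing
  open Elimination commutativeRing
  open FieldFacts F
  open import Algebra.Properties.Ring ring using (-‿distribˡ-*; +-inverseʳ-unique)
  open import Relation.Binary.Reasoning.Setoid setoid

  Any : Carrier → Set c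
  Any _ = ⊤

  zeroOrNonzero : ∀ {m} (u : Fin m → Carrier) → (∀ k → u k ≈ 0#) ⊎ (∃ λ k → ¬ u k ≈ 0#)
  zeroOrNonzero u with FinP.any? (λ k → ¬? (u k ≟ 0#))
  ... | yes nonzero = inj₂ nonzero
  ... | no  none    = inj₁ (λ k → decidable-stable (u k ≟ 0#) (λ uₖ≉0 → none (k , uₖ≉0)))

  zeroOrPivot : ∀ {N n} (v : Fin N → Fin n → Carrier) →
                (∀ k j → v k j ≈ 0#) ⊎ (∃₂ λ k j → ¬ v k j ≈ 0#)
  zeroOrPivot v with FinP.any? (λ k → FinP.any? (λ j → ¬? (v k j ≟ 0#)))
  ... | yes (k , j , v≉0) = inj₂ (k , j , v≉0)
  ... | no  none          = inj₁ (λ k j → decidable-stable (v k j ≟ 0#) (λ v≉0 → none (k , j , v≉0)))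

  -- Either the first
  -- coordinate vanishes throughout and can be dropped, or a pivot row clears it
  -- from the other N rows and a dependency among those extends to all rows.
  tall-dependent : ∀ {M N} → M ≤ N → (A : Fin (suc N) → Fin M → Carrier) → Dependent Any A
  tall-dependent {zero} _ A = (λ _ → 1#) , (λ _ → tt) , (zero , 1≉0) , λ ()
  tall-dependent {suc M} {suc N} (s≤s M≤N) A with zeroOrNonzero (λ k → A k zero)
  ... | inj₁ column≈0 = dropColumn (tall-dependent (ℕP.m≤n⇒m≤1+n M≤N) (λ k t → A k (suc t)))
    where
    dropColumn : Dependent Any (λ k t → A k (suc t)) → Dependent Any A
    dropColumn (coef , _ , nonzero , dep) = coef , (λ _ → tt) , nonzero , λ
      { zero    → sum-zero (λ k → coef k · A k zero) (λ k → trans (*-congˡ (column≈0 k)) (zeroʳ _))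
      ; (suc t) → dep t }
  ... | inj₂ (p , pivot≉0) with inverse (A p zero) pivot≉0
  ...   | ip , pivot·ip≈1 = extend (tall-dependent M≤N (λ k t → B k (suc t)))
    where
    B : Fin (suc N) → Fin (suc M) → Carrier
    B = clear (A ∘ punchIn p) (A p) zero ip
    extend : Dependent Any (λ k t → B k (suc t)) → Dependent Any A
    extend (c′ , _ , (k , c′ₖ≉0) , dep) = coef , (λ _ → tt) , (punchIn p k , coef≉0) , combination
      where
      S : Fin (suc M) → Carrier
      S t = sumF (λ k → c′ k · A (punchIn p k) t)
      coef : Fin (suc (suc N)) → Carrier
      coef = insertAt c′ p (- (S zero · ip))
      coef≉0 : ¬ coef (punchIn p k) ≈ 0#
      coef≉0 e = c′ₖ≉0 (trans (reflexive (≡.sym (insertAt-punchIn c′ p _ k))) e)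
      B-combination : ∀ t → sumF (λ k → c′ k · B k t) ≈ 0#
      B-combination zero    = sum-zero (λ k → c′ k · B k zero) λ k →
        trans (*-congˡ (clear-pivotColumn (A ∘ punchIn p) (A p) zero ip pivot·ip≈1 k)) (zeroʳ _)
      B-combination (suc t) = dep t
      combination : ∀ t → sumF (λ k → coef k · A k t) ≈ 0#
      combination t = begin
        sumF (λ k → coef k · A k t)
          ≈⟨ sum-punchIn p (λ k → coef k · A k t) ⟩
        coef p · A p t + sumF (λ k → coef (punchIn p k) · A (punchIn p k) t)
          ≈⟨ +-cong (*-congʳ (reflexive (insertAt-lookup c′ p _)))
                    (sum-cong {f = λ k → coef (punchIn p k) · A (punchIn p k) t}
                              (λ k → *-congʳ (reflexive (insertAt-punchIn c′ p _ k)))) ⟩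
        - (S zero · ip) · A p t + S t
          ≈⟨ trans (+-comm _ _) (+-congʳ (-‿distribˡ-* _ _)) ⟨
        S t - S zero · ip · A p t
          ≈⟨ clear-sum (A ∘ punchIn p) (A p) zero ip c′ t ⟨
        sumF (λ k → c′ k · B k t)
          ≈⟨ B-combination t ⟩
        0# ∎

  -- N+1 vectors in the span of M ≤ N vectors are linearly dependent: a
  -- dependency among their coefficient rows is a dependency among them.
  spanned-dependent : ∀ {M N n} → M ≤ N → (v : Fin (suc N) → Fin n → Carrier)
                      (z : Fin M → Fin n → Carrier) → InSpan Any v z → Dependent Any v
  spanned-dependent {M} {N} M≤N v z (A , _ , v≈Az) with tall-dependent M≤N A
  ... | coef , _ , nonzero , coefA≈0 = coef , (λ _ → tt) , nonzero , λ j → begin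
    sumF (λ k → coef k · v k j)
      ≈⟨ sum-cong {f = λ k → coef k · v k j} (λ k →
           trans (*-congˡ (v≈Az k j)) (sym (sum-*ˡ (coef k) (λ t → A k t · z t j)))) ⟩
    sumF (λ k → sumF (λ t → coef k · (A k t · z t j)))
      ≈⟨ sum-comm (λ k t → coef k · (A k t · z t j)) ⟩
    sumF (λ t → sumF (λ k → coef k · (A k t · z t j)))
      ≈⟨ sum-cong {M} (λ t → trans (sum-cong {f = λ k → coef k · (A k t · z t j)} (λ k → sym (*-assoc _ _ _)))
                                   (sum-*ʳ (z t j) (λ k → coef k · A k t))) ⟩
    sumF (λ t → sumF (λ k → coef k · A k t) · z t j)
      ≈⟨ sum-zero (λ t → sumF (λ k → coef k · A k t) · z t j) (λ t → trans (*-congʳ (coefA≈0 t)) (zeroˡ _)) ⟩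
    0# ∎

  module SpanExtraction {p} {P : Carrier → Set p} (sub : IsSubfield F P) where
    open IsSubfield sub

    SpannedBy≤ : ∀ {N n} → ℕ → (Fin N → Fin n → Carrier) → Set (c ⊔ ℓ ⊔ p)
    SpannedBy≤ {n = n} r v = Σ ℕ λ m → m ≤ r ×
      Σ (Fin m → Fin n → Carrier) λ z → (∀ t j → P (z t j)) × InSpan P v z

    zeroMember-dependent : ∀ {m n} (u : Fin m → Fin n → Carrier) q →
                           (∀ j → u q j ≈ 0#) → Dependent P u
    zeroMember-dependent u q u_q≈0 = δ , δ∈P , (q , δ_q≉0) , λ j → sum-zero _ (term j)
      where
      δ : Fin _ → Carrier
      δ k = if does (k FinP.≟ q) then 1# else 0#
      δ∈P : ∀ k → P (δ k)
      δ∈P k with k FinP.≟ q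
      ... | yes _ = 1∈
      ... | no  _ = 0∈
      δ_q≉0 : ¬ δ q ≈ 0#
      δ_q≉0 with q FinP.≟ q
      ... | yes _   = 1≉0
      ... | no  q≢q = contradiction ≡.refl q≢q
      term : ∀ j k → δ k · u k j ≈ 0#
      term j k with k FinP.≟ q
      ... | yes ≡.refl = trans (*-identityˡ _) (u_q≈0 j)
      ... | no  _      = zeroˡ _

    -- Rows h 0, …, h r
    -- either contain the (now zero) pivot row, or together with the pivot row
    -- they form r+2 distinct rows of v; a dependency c among the latter,
    -- c₀·V + S ≈ 0, restricts to a dependency of the cleared rows.
    clear-lowRank : ∀ {r N n} (v : Fin N → Fin n → Carrier) k₀ j₀ ip →
                    v k₀ j₀ · ip ≈ 1# → LowRank P (suc r) v → LowRank P r (clear v (v k₀) j₀ ip)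
    clear-lowRank {r} {n = n} v k₀ j₀ ip pivot·ip≈1 rank h h-inj
      with FinP.any? (λ q → h q FinP.≟ k₀)
    ... | yes (q , h_q≡k₀) = zeroMember-dependent (clear v (v k₀) j₀ ip ∘ h) q λ j →
            ≡.subst (λ k → clear v (v k₀) j₀ ip k j ≈ 0#) (≡.sym h_q≡k₀)
                    (clear-pivotRow (v k₀) j₀ ip pivot·ip≈1 j)
    ... | no  k₀∉h = restrict (rank (k₀ ∷ h) (∷-injective h-inj (λ q e → k₀∉h (q , e))))
      where
      restrict : Dependent P (v ∘ (k₀ ∷ h)) → Dependent P (clear v (v k₀) j₀ ip ∘ h)
      restrict (c , c∈P , (i , cᵢ≉0) , dep) = c ∘ suc , c∈P ∘ suc , nonzero i cᵢ≉0 , λ j →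
        trans (clear-sum (v ∘ h) (v k₀) j₀ ip (c ∘ suc) j)
              (clear-proportional (v k₀) S j₀ ip (c zero) pivot·ip≈1 S≈-c₀V j)
        where
        S : Fin n → Carrier
        S j = sumF (λ s → c (suc s) · v (h s) j)
        S≈-c₀V : ∀ j → S j ≈ - (c zero · v k₀ j)
        S≈-c₀V j = +-inverseʳ-unique _ _ (dep j)
        -- if only c₀ were nonzero, then c₀ · v k₀ j₀ ≈ 0 although v k₀ j₀ is invertible
        nonzero : ∀ i → ¬ c i ≈ 0# → ∃ λ s → ¬ c (suc s) ≈ 0#
        nonzero (suc s) cₛ≉0 = s , cₛ≉0
        nonzero zero    c₀≉0 with zeroOrNonzero (c ∘ suc)
        ... | inj₂ found  = found
        ... | inj₁ rest≈0 = ⊥-elim (nonzero-· c₀≉0 (invertible-nonzero pivot·ip≈1) (begin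
          c zero · v k₀ j₀                ≈⟨ +-identityʳ _ ⟨
          c zero · v k₀ j₀ + 0#           ≈⟨ +-congˡ (sum-zero (λ s → c (suc s) · v (h s) j₀)
                                                               (λ s → trans (*-congʳ (rest≈0 s)) (zeroˡ _))) ⟨
          c zero · v k₀ j₀ + S j₀         ≈⟨ dep j₀ ⟩
          0#                              ∎))

    -- Induction on r: if v is not zero, clear a pivot column and add the pivot
    -- row to a spanning family of the cleared rows.
    lowRank⇒spanned : ∀ r {N n} (v : Fin N → Fin n → Carrier) →
                      (∀ k j → P (v k j)) → LowRank P r v → SpannedBy≤ r v
    lowRank⇒spanned r v v∈P rank with zeroOrPivot v
    ... | inj₁ v≈0 = 0 , z≤n , (λ ()) , (λ ()) , (λ _ ()) , (λ _ ()) , v≈0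
    lowRank⇒spanned zero v v∈P rank | inj₂ (k₀ , j₀ , pivot≉0)
      with rank (λ _ → k₀) (λ { {zero} {zero} _ → ≡.refl })
    ... | c , _ , (zero , c₀≉0) , dep =
      contradiction (trans (sym (+-identityʳ _)) (dep j₀)) (nonzero-· c₀≉0 pivot≉0)
    lowRank⇒spanned (suc r) v v∈P rank | inj₂ (k₀ , j₀ , pivot≉0)
      with inverse∈ (v∈P k₀ j₀) pivot≉0
    ... | ip , ip∈P , pivot·ip≈1 =
      addPivotRow (lowRank⇒spanned r w w∈P (clear-lowRank v k₀ j₀ ip pivot·ip≈1 rank))
      where
      w : Fin _ → Fin _ → Carrier
      w = clear v (v k₀) j₀ ip
      μ : _ → Carrier
      μ k = v k j₀ · ip
      w∈P : ∀ k j → P (w k j)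
      w∈P k j = +∈ (v∈P k j) (-∈ (·∈ (·∈ (v∈P k j₀) ip∈P) (v∈P k₀ j)))
      addPivotRow : SpannedBy≤ r w → SpannedBy≤ (suc r) v
      addPivotRow (m , m≤r , z , z∈P , A , A∈P , w≈Az) =
        suc m , s≤s m≤r , v k₀ ∷ z ,
        (λ { zero j → v∈P k₀ j ; (suc t) j → z∈P t j }) ,
        (λ k → μ k ∷ A k) , (λ { k zero → ·∈ (v∈P k j₀) ip∈P ; k (suc t) → A∈P k t }) ,
        λ k j → trans (clear-restore v (v k₀) j₀ ip k j) (+-congˡ (w≈Az k j))

module Evaluation {c ℓ c′ ℓ′} (F : Field c ℓ) (K : Field c′ ℓ′)
                  (ι : Field.Carrier F → Field.Carrier K) (hom : IsFieldEmbedding F K ι)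
                  (γ : Field.Carrier K) where
  open Field K hiding (zero) renaming (_*_ to _·_)
  open Field F using () renaming (Carrier to Fc; _+_ to _+ᶠ_; _*_ to _·ᶠ_; -_ to -ᶠ_; 0# to 0ᶠ)
  open LinAlg commutativeRing using (sumF; pow)
  open Sums commutativeRing
  open Extension F K ι using (polyEval)
  open RingMorphisms.IsRingHomomorphism hom
  open import Algebra.Properties.CommutativeSemigroup *-commutativeSemigroup
    using (x∙yz≈y∙xz)
  open import Relation.Binary.Reasoning.Setoid setoid

  eval : ∀ {d} → (Fin d → Fc) → Carrier
  eval b = polyEval b γ

  eval-+ : ∀ {d} (b b′ : Fin d → Fc) → eval (λ i → b i +ᶠ b′ i) ≈ eval b + eval b′
  eval-+ {d} b b′ = trans (sum-cong {d} (λ i → trans (*-congʳ (+-homo _ _)) (distribʳ _ _ _)))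
                      (sum-+ (λ i → ι (b i) · pow γ (toℕ i)) (λ i → ι (b′ i) · pow γ (toℕ i)))

  eval-scale : ∀ {d} a (b : Fin d → Fc) → eval (λ i → a ·ᶠ b i) ≈ ι a · eval b
  eval-scale {d} a b = trans (sum-cong {d} (λ i → trans (*-congʳ (*-homo _ _)) (*-assoc _ _ _)))
                         (sum-*ˡ (ι a) (λ i → ι (b i) · pow γ (toℕ i)))

  eval-neg : ∀ {d} (b : Fin d → Fc) → eval (λ i → -ᶠ b i) ≈ - eval b
  eval-neg {d} b = trans (sum-cong {d} (λ i → trans (*-congʳ (-‿homo _)) (sym (-‿distribˡ-* _ _))))
                     (sum-neg (λ i → ι (b i) · pow γ (toℕ i)))
    where open import Algebra.Properties.Ring ring using (-‿distribˡ-*)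

  eval-zero : ∀ {d} → eval {d} (λ _ → 0ᶠ) ≈ 0#
  eval-zero {d} = sum-zero {d} (λ i → ι 0ᶠ · pow γ (toℕ i)) (λ i → trans (*-congʳ 0#-homo) (zeroˡ _))

  eval-const : ∀ {d} a → eval {suc d} (a ∷ λ _ → 0ᶠ) ≈ ι a
  eval-const {d} a = trans (+-cong (*-identityʳ _) higher≈0) (+-identityʳ _)
    where
    higher≈0 : sumF {d} (λ i → ι 0ᶠ · pow γ (suc (toℕ i))) ≈ 0#
    higher≈0 = sum-zero {d} (λ i → ι 0ᶠ · pow γ (suc (toℕ i))) (λ i → trans (*-congʳ 0#-homo) (zeroˡ _))

  eval-horner : ∀ {d} (b : Fin (suc d) → Fc) → eval b ≈ ι (b zero) + γ · eval (b ∘ suc)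
  eval-horner {d} b = +-cong (*-identityʳ _)
    (trans (sum-cong {d} (λ i → x∙yz≈y∙xz _ _ _)) (sum-*ˡ γ (λ i → ι (b (suc i)) · pow γ (toℕ i))))

  eval-top : ∀ {d} (b : Fin (suc d) → Fc) →
             eval b ≈ eval (b ∘ inject₁) + ι (b (fromℕ d)) · pow γ d
  eval-top {d} b = trans (sum-last (λ i → ι (b i) · pow γ (toℕ i)))
    (+-cong (sum-cong {d} (λ i → *-congˡ (reflexive (≡.cong (pow γ) (FinP.toℕ-inject₁ i)))))
            (*-congˡ (reflexive (≡.cong (pow γ) (FinP.toℕ-fromℕ d)))))

  eval-shift : ∀ {d} (b : Fin (suc d) → Fc) →
               γ · eval b ≈ eval (0ᶠ ∷ b ∘ inject₁) + ι (b (fromℕ d)) · pow γ (suc d)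
  eval-shift {d} b = begin
    γ · eval b
      ≈⟨ *-congˡ (eval-top b) ⟩
    γ · (eval (b ∘ inject₁) + ι (b (fromℕ d)) · pow γ d)
      ≈⟨ distribˡ γ _ _ ⟩
    γ · eval (b ∘ inject₁) + γ · (ι (b (fromℕ d)) · pow γ d)
      ≈⟨ +-cong (trans (eval-horner (0ᶠ ∷ b ∘ inject₁)) (trans (+-congʳ 0#-homo) (+-identityˡ _)))
                (x∙yz≈y∙xz _ _ _) ⟨
    eval (0ᶠ ∷ b ∘ inject₁) + ι (b (fromℕ d)) · pow γ (suc d) ∎

-- F[γ] for γ of degree g = g′ + 1 over F: the elements with coordinates in the
-- F-basis 1, γ, …, γ^(g-1).  The minimal polynomial X^g + Σ a₀ᵢ Xⁱ rewrites γ^g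
-- in this basis, which makes the coordinate representation closed under products.
module Adjoin {c ℓ c′ ℓ′} (F : Field c ℓ) (K : Field c′ ℓ′)
              (ι : Field.Carrier F → Field.Carrier K) (hom : IsFieldEmbedding F K ι)
              (γ : Field.Carrier K) (g′ : ℕ) (degree : Extension.HasDegree F K ι γ (suc g′)) where
  open Field K hiding (zero) renaming (_*_ to _·_)
  open Field F using () renaming (Carrier to Fc; _≈_ to _≈ᶠ_; _+_ to _+ᶠ_; _*_ to _·ᶠ_;
                                  -_ to -ᶠ_; 0# to 0ᶠ; 1# to 1ᶠ)
  module F = Field F
  open LinAlg commutativeRing using (sumF; pow)
  open Extension F K ι using (InAdjoin)
  open Evaluation F K ι hom γ
  open RingMorphisms.IsRingHomomorphism hom
  open import Algebra.Properties.Ring ring using (-‿distribˡ-*; -‿distribʳ-*; +-inverseʳ-unique)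
  open import Relation.Binary.Reasoning.Setoid setoid

  g : ℕ
  g = suc g′

  a₀ : Fin g → Fc
  a₀ = proj₁ (proj₁ degree)

  γ^g≈ : pow γ g ≈ - eval a₀
  γ^g≈ = +-inverseʳ-unique _ _ (trans (+-comm _ _) (proj₂ (proj₁ degree)))

  Coords : Carrier → Set (c ⊔ ℓ′)
  Coords x = Σ (Fin g → Fc) λ b → x ≈ eval b

  Coords-cong : ∀ {x y} → x ≈ y → Coords x → Coords y
  Coords-cong x≈y (b , x≈b) = b , trans (sym x≈y) x≈b

  Coords-ι : ∀ a → Coords (ι a)
  Coords-ι a = (a ∷ λ _ → 0ᶠ) , sym (eval-const {g′} a)

  Coords-0 : Coords 0#
  Coords-0 = (λ _ → 0ᶠ) , sym (eval-zero {g})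

  Coords-1 : Coords 1#
  Coords-1 = Coords-cong 1#-homo (Coords-ι 1ᶠ)

  Coords-+ : ∀ {x y} → Coords x → Coords y → Coords (x + y)
  Coords-+ (b , x≈b) (b′ , y≈b′) = (λ i → b i +ᶠ b′ i) , trans (+-cong x≈b y≈b′) (sym (eval-+ b b′))

  Coords-scale : ∀ a {x} → Coords x → Coords (ι a · x)
  Coords-scale a (b , x≈b) = (λ i → a ·ᶠ b i) , trans (*-congˡ x≈b) (sym (eval-scale a b))

  Coords-neg : ∀ {x} → Coords x → Coords (- x)
  Coords-neg (b , x≈b) = (λ i → -ᶠ b i) , trans (-‿cong x≈b) (sym (eval-neg b))

  -- Multiplication by γ: the overflowing term ι(b_top) γ^g is rewritten by the
  -- minimal polynomial.
  Coords-γ· : ∀ {x} → Coords x → Coords (γ · x)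
  Coords-γ· {x} (b , x≈b) = (λ i → (0ᶠ ∷ b ∘ inject₁) i +ᶠ -ᶠ top ·ᶠ a₀ i) , (begin
    γ · x                                         ≈⟨ *-congˡ x≈b ⟩
    γ · eval b                                    ≈⟨ eval-shift b ⟩
    eval (0ᶠ ∷ b ∘ inject₁) + ι top · pow γ g     ≈⟨ +-congˡ (*-congˡ γ^g≈) ⟩
    eval (0ᶠ ∷ b ∘ inject₁) + ι top · - eval a₀   ≈⟨ +-congˡ overflow ⟩
    eval (0ᶠ ∷ b ∘ inject₁) + eval (λ i → -ᶠ top ·ᶠ a₀ i)
      ≈⟨ eval-+ (0ᶠ ∷ b ∘ inject₁) (λ i → -ᶠ top ·ᶠ a₀ i) ⟨
    eval (λ i → (0ᶠ ∷ b ∘ inject₁) i +ᶠ -ᶠ top ·ᶠ a₀ i) ∎)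
    where
    top : Fc
    top = b (fromℕ g′)
    overflow : ι top · - eval a₀ ≈ eval (λ i → -ᶠ top ·ᶠ a₀ i)
    overflow = begin
      ι top · - eval a₀     ≈⟨ -‿distribʳ-* _ _ ⟨
      - (ι top · eval a₀)   ≈⟨ -‿distribˡ-* _ _ ⟩
      - ι top · eval a₀     ≈⟨ *-congʳ (-‿homo top) ⟨
      ι (-ᶠ top) · eval a₀  ≈⟨ eval-scale (-ᶠ top) a₀ ⟨
      eval (λ i → -ᶠ top ·ᶠ a₀ i) ∎

  Coords-γ : Coords γ
  Coords-γ = Coords-cong (*-identityʳ γ) (Coords-γ· Coords-1)

  Coords-eval· : ∀ {d} (p : Fin d → Fc) {y} → Coords y → Coords (eval p · y)
  Coords-eval· {zero}  p {y} _  = Coords-cong (sym (zeroˡ y)) Coords-0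
  Coords-eval· {suc d} p {y} ry = Coords-cong (sym (begin
    eval p · y                                ≈⟨ *-congʳ (eval-horner p) ⟩
    (ι (p zero) + γ · eval (p ∘ suc)) · y     ≈⟨ distribʳ y _ _ ⟩
    ι (p zero) · y + γ · eval (p ∘ suc) · y   ≈⟨ +-congˡ (*-assoc _ _ _) ⟩
    ι (p zero) · y + γ · (eval (p ∘ suc) · y) ∎))
    (Coords-+ (Coords-scale (p zero) ry) (Coords-γ· (Coords-eval· (p ∘ suc) ry)))

  Coords-· : ∀ {x y} → Coords x → Coords y → Coords (x · y)
  Coords-· (b , x≈b) ry = Coords-cong (*-congʳ (sym x≈b)) (Coords-eval· b ry)

  Coords-pow : ∀ {x} → Coords x → ∀ k → Coords (pow x k)
  Coords-pow rx zero    = Coords-1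
  Coords-pow rx (suc k) = Coords-· rx (Coords-pow rx k)

  Coords-adjoin : ∀ {x} → InAdjoin γ x → Coords x
  Coords-adjoin (d , p , x≈p) = Coords-cong (trans (*-identityʳ _) (sym x≈p)) (Coords-eval· p Coords-1)

  Coords-combination : ∀ {m} (A : Fin m → Fc) {z : Fin m → Carrier} →
                       (∀ t → Coords (z t)) → Coords (sumF (λ t → ι (A t) · z t))
  Coords-combination {zero}  A rz = Coords-0
  Coords-combination {suc m} A rz =
    Coords-+ (Coords-scale (A zero) (rz zero)) (Coords-combination (A ∘ suc) (rz ∘ suc))

  -- In a finite K, F[γ] is a subfield: the inverse of x is a power of x.
  Coords-subfield : IsFinite K → IsSubfield K Coords
  Coords-subfield finite = record
    { 0∈ = Coords-0 ; 1∈ = Coords-1 ; +∈ = Coords-+ ; -∈ = Coords-neg ; ·∈ = Coords-·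
    ; inverse∈ = λ {x} rx x≉0 → let (o , x·xᵒ≈1) = FieldFacts.inverse-power K finite x≉0
                                 in pow x o , Coords-pow rx o , x·xᵒ≈1 }

  module Uniqueness (_≟ᶠ_ : Decidable _≈ᶠ_) where
    open LinAlg F.commutativeRing using () renaming (sumF to sumᶠ)

    -- A polynomial with d+1 ≤ g coefficients vanishing at γ has leading
    -- coefficient zero: otherwise dividing by it would give a monic polynomial
    -- of degree d < g vanishing at γ, contradicting the minimality of g.
    leading≈0 : ∀ {d} → suc d ≤ g → (b : Fin (suc d) → Fc) → eval b ≈ 0# → b (fromℕ d) ≈ᶠ 0ᶠ
    leading≈0 {d} d<g b b≈0 with b (fromℕ d) ≟ᶠ 0ᶠ
    ... | yes t≈0 = t≈0
    ... | no  t≉0 with F.inverse (b (fromℕ d)) t≉0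
    ...   | t⁻¹ , t·t⁻¹≈1 = contradiction (proj₂ degree d monic monic≈0) (ℕP.<⇒≱ d<g)
      where
      t : Fc
      t = b (fromℕ d)
      monic : Fin d → Fc
      monic k = t⁻¹ ·ᶠ b (inject₁ k)
      ιt⁻¹·ιt≈1 : ι t⁻¹ · ι t ≈ 1#
      ιt⁻¹·ιt≈1 = trans (sym (*-homo t⁻¹ t)) (trans (⟦⟧-cong (F.trans (F.*-comm t⁻¹ t) t·t⁻¹≈1)) 1#-homo)
      monic≈0 : pow γ d + eval monic ≈ 0#
      monic≈0 = begin
        pow γ d + eval monic
          ≈⟨ +-cong (trans (*-congʳ ιt⁻¹·ιt≈1) (*-identityˡ _)) (sym (eval-scale t⁻¹ (b ∘ inject₁))) ⟨
        ι t⁻¹ · ι t · pow γ d + ι t⁻¹ · eval (b ∘ inject₁)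
          ≈⟨ trans (+-comm _ _) (+-congˡ (*-assoc _ _ _)) ⟩
        ι t⁻¹ · eval (b ∘ inject₁) + ι t⁻¹ · (ι t · pow γ d)
          ≈⟨ distribˡ _ _ _ ⟨
        ι t⁻¹ · (eval (b ∘ inject₁) + ι t · pow γ d)
          ≈⟨ *-congˡ (trans (sym (eval-top b)) b≈0) ⟩
        ι t⁻¹ · 0#
          ≈⟨ zeroʳ _ ⟩
        0# ∎

    vanishing : ∀ {d} → d ≤ g → (b : Fin d → Fc) → eval b ≈ 0# → ∀ i → b i ≈ᶠ 0ᶠ
    vanishing {zero}  _   b _   ()
    vanishing {suc d} d<g b b≈0 i with view i
    ... | ‵fromℕ          = leading≈0 d<g b b≈0
    ... | ‵inj₁ {i = j} _ = vanishing (ℕP.<⇒≤ d<g) (b ∘ inject₁) lower≈0 j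
      where
      lower≈0 : eval (b ∘ inject₁) ≈ 0#
      lower≈0 = begin
        eval (b ∘ inject₁)                               ≈⟨ +-identityʳ _ ⟨
        eval (b ∘ inject₁) + 0#
          ≈⟨ +-congˡ (trans (*-congʳ (trans (⟦⟧-cong (leading≈0 d<g b b≈0)) 0#-homo)) (zeroˡ _)) ⟨
        eval (b ∘ inject₁) + ι (b (fromℕ d)) · pow γ d   ≈⟨ eval-top b ⟨
        eval b                                           ≈⟨ b≈0 ⟩
        0#                                               ∎

    const : ∀ {x} → Coords x → Fc
    const (b , _) = b zero

    const-cong : ∀ {x y} → x ≈ y → (rx : Coords x) (ry : Coords y) → const rx ≈ᶠ const ry
    const-cong {x} {y} x≈y (b , x≈b) (b′ , y≈b′) =
      x∙y⁻¹≈ε⇒x≈y _ _ (vanishing ℕP.≤-refl (λ i → b i +ᶠ -ᶠ b′ i) difference≈0 zero)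
      where
      open import Algebra.Properties.Group F.+-group using (x∙y⁻¹≈ε⇒x≈y)
      difference≈0 : eval (λ i → b i +ᶠ -ᶠ b′ i) ≈ 0#
      difference≈0 = begin
        eval (λ i → b i +ᶠ -ᶠ b′ i)     ≈⟨ eval-+ b (λ i → -ᶠ b′ i) ⟩
        eval b + eval (λ i → -ᶠ b′ i)   ≈⟨ +-cong (sym x≈b) (eval-neg b′) ⟩
        x - eval b′                     ≈⟨ +-congˡ (-‿cong (trans (sym y≈b′) (sym x≈y))) ⟩
        x - x                           ≈⟨ -‿inverseʳ x ⟩
        0#                              ∎

    const-combination : ∀ {m} (A : Fin m → Fc) {z : Fin m → Carrier} (rz : ∀ t → Coords (z t)) →
                        const (Coords-combination A rz) ≈ᶠ sumᶠ (λ t → A t ·ᶠ const (rz t))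
    const-combination {zero}  A rz = F.refl
    const-combination {suc m} A rz = F.+-cong F.refl (const-combination (A ∘ suc) (rz ∘ suc))
module Transfer {c ℓ c′ ℓ′} (F : Field c ℓ) (K : Field c′ ℓ′)
                (ι : Field.Carrier F → Field.Carrier K) (hom : IsFieldEmbedding F K ι)
                (γ : Field.Carrier K) (g′ : ℕ) (degree : Extension.HasDegree F K ι γ (suc g′))
                (_≟ᶠ_ : Decidable (Field._≈_ F)) (_≟_ : Decidable (Field._≈_ K))
                (finite : IsFinite K) where
  open Field K hiding (zero) renaming (_*_ to _·_)
  open Field F using () renaming (Carrier to Fc)
  open LinAlg commutativeRing using (sumF; pow)
  open Sums commutativeRing
  open Families commutativeRing
  open Extension F K ι using (InAdjoin)
  open Adjoin F K ι hom γ g′ degree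
  open Evaluation F K ι hom γ using (eval)
  open Uniqueness _≟ᶠ_
  open LinearAlgebra F _≟ᶠ_ using (Any; spanned-dependent)
  open LinearAlgebra.SpanExtraction K _≟_ (Coords-subfield finite) using (lowRank⇒spanned)
  open import Relation.Binary.Reasoning.Setoid setoid

  InFSpan : ∀ {N m n} → (Fin N → Fin n → Carrier) → (Fin m → Fin n → Carrier) → Set (c ⊔ ℓ′)
  InFSpan {N} {m} v z =
    Σ (Fin N → Fin m → Fc) λ B → ∀ k j → v k j ≈ sumF (λ t → ι (B k t) · z t j)

  -- An F[γ]-combination of m vectors is an F-combination of the m·g vectors
  -- γⁱ · z t, by expanding each coefficient in the basis 1, γ, …, γ^(g-1).
  expand : ∀ {N m n} (A : Fin N → Fin m → Carrier) (z : Fin m → Fin n → Carrier) →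
           (∀ k t → Coords (A k t)) → (∀ t j → Coords (z t j)) →
           Σ (Fin (m ℕ.* g) → Fin n → Carrier) λ z′ → (∀ s j → Coords (z′ s j)) ×
             InFSpan (λ k j → sumF (λ t → A k t · z t j)) z′
  expand {m = zero}  A z rA rz = (λ ()) , (λ ()) , (λ _ ()) , λ _ _ → refl
  expand {N} {suc m} A z rA rz
    with expand (λ k → A k ∘ suc) (z ∘ suc) (λ k → rA k ∘ suc) (rz ∘ suc)
  ... | z″ , rz″ , B″ , eq″ =
    multiples ++ z″ , ++-all (λ u → ∀ j → Coords (u j)) {f = multiples} {h = z″} rmultiples rz″ ,
    (λ k → coeffs k ++ B″ k) , eq
    where
    multiples : Fin g → Fin _ → Carrier
    multiples i j = pow γ (toℕ i) · z zero j
    rmultiples : ∀ i j → Coords (multiples i j)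
    rmultiples i j = Coords-· (Coords-pow Coords-γ (toℕ i)) (rz zero j)
    coeffs : Fin N → Fin g → Fc
    coeffs k = proj₁ (rA k zero)
    eq : ∀ k j → sumF (λ t → A k t · z t j) ≈
                 sumF (λ s → ι ((coeffs k ++ B″ k) s) · (multiples ++ z″) s j)
    eq k j = begin
      A k zero · z zero j + sumF (λ t → A k (suc t) · z (suc t) j)
        ≈⟨ +-cong first (eq″ k j) ⟩
      sumF (λ i → ι (coeffs k i) · multiples i j) + sumF (λ s → ι (B″ k s) · z″ s j)
        ≈⟨ sum-++ (coeffs k) (B″ k) multiples z″ (λ b u → ι b · u j) ⟨
      sumF (λ s → ι ((coeffs k ++ B″ k) s) · (multiples ++ z″) s j) ∎
      where
      first : A k zero · z zero j ≈ sumF (λ i → ι (coeffs k i) · multiples i j)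
      first = begin
        A k zero · z zero j
          ≈⟨ *-congʳ (proj₂ (rA k zero)) ⟩
        eval (coeffs k) · z zero j
          ≈⟨ sum-*ʳ (z zero j) (λ i → ι (coeffs k i) · pow γ (toℕ i)) ⟨
        sumF (λ i → ι (coeffs k i) · pow γ (toℕ i) · z zero j)
          ≈⟨ sum-cong {g} (λ i → *-assoc (ι (coeffs k i)) (pow γ (toℕ i)) (z zero j)) ⟩
        sumF (λ i → ι (coeffs k i) · multiples i j) ∎

  project : ∀ {N m n} {v : Fin N → Fin n → Carrier} {z : Fin m → Fin n → Carrier} →
            InFSpan v z → (rv : ∀ k j → Coords (v k j)) (rz : ∀ t j → Coords (z t j)) →
            Families.InSpan F.commutativeRing Any (λ k j → const (rv k j)) (λ t j → const (rz t j))
  project (B , v≈Bz) rv rz = B , (λ _ _ → tt) , λ k j →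
    F.trans (const-cong (v≈Bz k j) (rv k j) (Coords-combination (B k) (λ t → rz t j)))
            (const-combination (B k) (λ t → rz t j))

  -- Rank ≤ r over F[γ] gives rank ≤ g·r over F of the constant coordinates:
  -- g·r+1 rows are spanned by m ≤ r vectors over F[γ], hence by m·g ≤ g·r
  -- vectors over F, hence dependent.
  rank-transfer : ∀ {n r} (X : Matrix Carrier n) (rX : ∀ i j → Coords (X i j)) →
                  LinAlg.Over.RankAtMost commutativeRing (InAdjoin γ) r X →
                  LinAlg.Over.RankAtMost F.commutativeRing Any (g * r) (λ i j → const (rX i j))
  rank-transfer {n} {r} X rX rank f f-inj =
    let (m , m≤r , z , rz , A , rA , v≈Az) = lowRank⇒spanned r (X ∘ f) (rX ∘ f) lowRank
        (z′ , rz′ , B , Az≈Bz′) = expand A z rA rz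
    in spanned-dependent (bound m≤r) _ _
         (project (B , λ k j → trans (v≈Az k j) (Az≈Bz′ k j)) (rX ∘ f) rz′)
    where
    lowRank : LowRank Coords r (X ∘ f)
    lowRank h h-inj with rank (f ∘ h) (λ e → h-inj (f-inj e))
    ... | coef , coef∈ , nonzero , dep = coef , Coords-adjoin ∘ coef∈ , nonzero , dep
    bound : ∀ {m} → m ≤ r → m ℕ.* g ≤ g * r
    bound m≤r = ℕP.≤-trans (ℕP.*-monoˡ-≤ g m≤r) (ℕP.≤-reflexive (ℕP.*-comm r g))

  -- A decomposition M = E + F over F[γ] projects to one over F with the same
  -- sparsity (zero entries stay zero) and rank bound g·r.
  decomposition-transfer : ∀ {n r s} (M : Matrix Fc n) →
    LinAlg.Over.Decomposable commutativeRing (InAdjoin γ) (λ i j → ι (M i j)) r s →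
    LinAlg.Over.Decomposable F.commutativeRing Any M (g * r) s
  decomposition-transfer {n} {r} {s} M (E , X , E∈ , X∈ , rowsE , colsE , rankX , M≈E+X) =
    E′ , X′ , (λ _ _ → tt) , (λ _ _ → tt) , rows′ , cols′ , rank-transfer X rX rankX , M≈E′+X′
    where
    rE : ∀ i j → Coords (E i j)
    rE i j = Coords-adjoin (E∈ i j)
    rX : ∀ i j → Coords (X i j)
    rX i j = Coords-adjoin (X∈ i j)
    E′ X′ : Matrix Fc n
    E′ i j = const (rE i j)
    X′ i j = const (rX i j)
    rows′ : LinAlg.Over.SparseRows F.commutativeRing Any s E′
    rows′ i = let (js , length≤s , outside≈0) = rowsE i
              in js , length≤s , λ j j∉js → const-cong (outside≈0 j j∉js) (rE i j) Coords-0
    cols′ : LinAlg.Over.SparseCols F.commutativeRing Any s E′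
    cols′ j = let (is , length≤s , outside≈0) = colsE j
              in is , length≤s , λ i i∉is → const-cong (outside≈0 i i∉is) (rE i j) Coords-0
    M≈E′+X′ : ∀ i j → M i j F.≈ E′ i j F.+ X′ i j
    M≈E′+X′ i j = const-cong (M≈E+X i j) (Coords-ι (M i j)) (Coords-+ (rE i j) (rX i j))

¬¬-finite : ∀ {m p} {Q : Fin m → Set p} → (∀ i → ¬ ¬ Q i) → ¬ ¬ (∀ i → Q i)
¬¬-finite {zero}  _  ¬all = ¬all (λ ())
¬¬-finite {suc m} ¬¬Q ¬all = ¬¬Q zero λ Q₀ →
  ¬¬-finite (¬¬Q ∘ suc) λ Qₛ → ¬all λ { zero → Q₀ ; (suc i) → Qₛ i }

-- Equality in a finite field is decidable up to double negation: through an
-- enumeration it reduces to finitely many instances of excluded middle.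
finite⇒¬¬decidable : ∀ {c ℓ} (F : Field c ℓ) → IsFinite F → ¬ ¬ Decidable (Field._≈_ F)
finite⇒¬¬decidable F (q , e , onto) =
  ¬¬-map decide (¬¬-finite λ i → ¬¬-finite λ j → ¬¬-excluded-middle)
  where
  open Field F
  index : Carrier → Fin q
  index x = proj₁ (onto x)
  decide : (∀ i j → Dec (e i ≈ e j)) → Decidable _≈_
  decide d x y = map′ (λ eᵢ≈eⱼ → trans (sym (proj₂ (onto x))) (trans eᵢ≈eⱼ (proj₂ (onto y))))
                      (λ x≈y → trans (proj₂ (onto x)) (trans x≈y (sym (proj₂ (onto y)))))
                      (d (index x) (index y))

no-degree-zero : ∀ {c ℓ c′ ℓ′} (F : Field c ℓ) (K : Field c′ ℓ′) (ι : Field.Carrier F → Field.Carrier K)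
                 (γ : Field.Carrier K) → ¬ Extension.HasDegree F K ι γ 0
no-degree-zero F K ι γ ((_ , 1+0≈0) , _) = 1≉0 (trans (sym (+-identityʳ 1#)) 1+0≈0)
  where open Field K

lemma7p20 : ∀ {c ℓ c' ℓ'} (F : Field c ℓ) (K : Field c' ℓ')
            (ι : Field.Carrier F → Field.Carrier K) →
            IsFinite F → IsFinite K → IsFieldEmbedding F K ι →
            (γ : Field.Carrier K) → ¬ (Field._≈_ K γ (Field.0# K)) →
            (g : ℕ) → Extension.HasDegree F K ι γ g →
            (n : ℕ) (M : Matrix (Field.Carrier F) n) (r : ℕ) → 1 ≤ r →
            (s₁ s₂ : ℕ) →
            LinAlg.Over.IsRigidity (Field.commutativeRing F) (λ _ → ⊤ {c}) M (g * r) s₁ →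
            LinAlg.Over.IsRigidity (Field.commutativeRing K) (Extension.InAdjoin F K ι γ)
              (λ i j → ι (M i j)) r s₂ →
            s₁ ≤ s₂
lemma7p20 F K ι _ _ _ γ _ zero degree = ⊥-elim (no-degree-zero F K ι γ degree)
lemma7p20 F K ι finiteF finiteK hom γ _ (suc g′) degree n M r _ s₁ s₂
          (_ , minimal₁) (decomposable₂ , _) =
  decidable-stable (s₁ ℕ.≤? s₂) λ s₁≰s₂ →
    finite⇒¬¬decidable F finiteF λ _≟ᶠ_ →
    finite⇒¬¬decidable K finiteK λ _≟_ →
    s₁≰s₂ (minimal₁ s₂ (Transfer.decomposition-transfer F K ι hom γ g′ degree _≟ᶠ_ _≟_ finiteK
                          M decomposable₂))
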